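{- Let $H$ be a canonical 2-edge cover of a $5/4$-structured graph $G$. Then $\mathsf{cost}(H)\le \frac{5}{4}|H|$.
   Context: A graph is 2EC if it is connected and remains connected after deleting any edge; 2VC if connected, at least three vertices, no cut vertex. For $\alpha>1$, $G$ is $\alpha$-structured if it is simple, 2VC, has at least $\frac{4}{\alpha-1}$ vertices, has no $\alpha$-contractible subgraph with at most $\frac{2}{\alpha-1}$ vertices (a 2EC subgraph $C$ such that every 2EC spanning subgraph of $G$ contains at least $|E(C)|/\alpha$ edges of $G[V(C)]$), has no edge $uv$ with $\{u,v\}$ a 2-vertex cut, and every 2-vertex cut $\{u,v\}$ leaves exactly two components one of which is a single vertex. A 2-edge cover is $H\subseteq E(G)$ with every vertex incident to at least two edges of $H$; components are those of $(V(G),H)$; triangle-free means no component is a triangle; a component is complex if not 2EC; a 2EC block is a maximal 2EC subgraph of $H$ with at least one edge; a bridge is an edge whose removal increases the number of connected components. $H$ is canonical if (1) triangle-free, (2) every component with fewer than 8 edges is a cycle, (3) every 2EC block of a complex component has at least 4 edges, (4) every complex component has at least two 2EC blocks with at least 6 edges each, (5) some component has at least 8 vertices. Credits: a 2EC component $C$ with $|E(C)|<8$ (small) receives $|E(C)|/4$ credits; a 2EC component with $|E(C)|\ge 8$ (large) receives $2$ credits; each complex component receives $1$ credit; each 2EC block of a complex component receives $1$ credit; each bridge of a complex component receives $1/4$ credit. $\mathsf{cr}(H)$ is the total number of credits and $\mathsf{cost}(H)=|H|+\mathsf{cr}(H)$. -}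

module Defs where

open import Data.Nat using (ℕ; _+_; _*_; _∸_; _≤_; _<_)
open import Data.Bool using (Bool; true; false; _∧_; _∨_; not)
open import Data.Fin using (Fin)
open import Data.Fin.Properties using (_≟_)
open import Data.Fin.Subset
  using (Subset; _∈_; _⊆_; _∩_; _─_; _-_; ∁; ⁅_⁆; ∣_∣; Nonempty)
  renaming (⊤ to Full)
open import Data.Vec using (lookup; tabulate)
open import Data.List using (List; []; _∷_; length)
open import Data.List.Membership.Propositional using () renaming (_∈_ to _∈ₗ_)
open import Data.List.Relation.Unary.Unique.Propositional using (Unique)
open import Data.Product using (Σ; ∃; ∃-syntax; _×_; _,_)
open import Data.Sum using (_⊎_)
open import Relation.Nullary using (¬_; ⌊_⌋)
open import Relation.Binary.PropositionalEquality using (_≡_; _≢_)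
open import Function.Bundles using (_⇔_)

Count : {A : Set} → (A → Set) → ℕ → Set
Count {A} P k =
  Σ (List A) λ xs → Unique xs × (∀ x → (P x ⇔ (x ∈ₗ xs))) × (length xs ≡ k)

-- E(G) is the full subset of Fin m.
-- Subgraphs are pairs (S , F) of a vertex set S : Subset n and an edge set
-- F : Subset m.

record Graph : Set where
  field
    n   : ℕ
    m   : ℕ
    src : Fin m → Fin n
    tgt : Fin m → Fin n

module _ (G : Graph) where
  open Graph G

  Simple : Set
  Simple = (∀ e → src e ≢ tgt e)
         × (∀ e f → ((src e ≡ src f × tgt e ≡ tgt f) ⊎ (src e ≡ tgt f × tgt e ≡ src f))
                  → e ≡ f)

  Adj : Subset m → Fin n → Fin n → Set
  Adj F x y = ∃[ e ] (e ∈ F × ((src e ≡ x × tgt e ≡ y) ⊎ (src e ≡ y × tgt e ≡ x)))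

  data Reach (F : Subset m) : Fin n → Fin n → Set where
    here : ∀ {x} → Reach F x x
    step : ∀ {x y z} → Adj F x y → Reach F y z → Reach F x z

  IsSubgraph : Subset n → Subset m → Set
  IsSubgraph S F = ∀ e → e ∈ F → (src e ∈ S × tgt e ∈ S)

  within : Subset n → Subset m
  within X = tabulate λ e → lookup X (src e) ∧ lookup X (tgt e)

  avoiding : Subset n → Subset m
  avoiding X = tabulate λ e → not (lookup X (src e)) ∧ not (lookup X (tgt e))

  incident : Fin n → Subset m
  incident x = tabulate λ e → ⌊ src e ≟ x ⌋ ∨ ⌊ tgt e ≟ x ⌋

  deg : Subset m → Fin n → ℕ
  deg F x = ∣ F ∩ incident x ∣

  Connected : Subset n → Subset m → Set
  Connected S F = Nonempty S × (∀ x y → x ∈ S → y ∈ S → Reach F x y)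

  TwoEC : Subset n → Subset m → Set
  TwoEC S F = Connected S F × (∀ e → e ∈ F → Connected S (F - e))

  -- G - X (vertices not in X, edges avoiding X)
  -- 2VC: connected, at least three vertices, no cut vertex
  TwoVC : Set
  TwoVC = Connected Full Full × 3 ≤ n
        × (∀ w → Connected (Full - w) (avoiding ⁅ w ⁆))

  -- connected components of the graph (S , F) (F ⊆ edges inside S)
  IsComponent : Subset n → Subset m → Subset n → Set
  IsComponent S F K =
    K ⊆ S × Nonempty K × (∀ x → x ∈ K → ∀ y → (y ∈ K ⇔ (y ∈ S × Reach F x y)))

  NumComponents : Subset n → Subset m → ℕ → Set
  NumComponents S F k = Count (IsComponent S F) k

  TwoVertexCut : Fin n → Fin n → Set
  TwoVertexCut u v =
    u ≢ v × ¬ Connected ((Full - u) - v) (avoiding (⁅ u ⁆ Data.Fin.Subset.∪ ⁅ v ⁆))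

  -- α-contractible subgraph, α = p / q
  Contractible : ℕ → ℕ → Subset n → Subset m → Set
  Contractible p q S F =
    IsSubgraph S F × 2 ≤ ∣ S ∣ × TwoEC S F
    × (∀ F' → TwoEC Full F' → q * ∣ F ∣ ≤ p * ∣ F' ∩ within S ∣)

  -- α-structured, α = p / q with q < p  (so 1/(α-1) = q/(p-q))
  Structured : ℕ → ℕ → Set
  Structured p q =
    q < p × Simple × TwoVC
    × 4 * q ≤ n * (p ∸ q)
    × (∀ S F → Contractible p q S F → ¬ (∣ S ∣ * (p ∸ q) ≤ 2 * q))
    × (∀ e → ¬ TwoVertexCut (src e) (tgt e))
    × (∀ u v → TwoVertexCut u v →
         NumComponents ((Full - u) - v) (avoiding (⁅ u ⁆ Data.Fin.Subset.∪ ⁅ v ⁆)) 2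
         × ∃[ K ] (IsComponent ((Full - u) - v)
                     (avoiding (⁅ u ⁆ Data.Fin.Subset.∪ ⁅ v ⁆)) K × ∣ K ∣ ≡ 1))

  TwoEdgeCover : Subset m → Set
  TwoEdgeCover H = ∀ x → 2 ≤ deg H x

  Comp : Subset m → Subset n → Set
  Comp H K = IsComponent Full H K

  compEdges : Subset m → Subset n → Subset m
  compEdges H K = H ∩ within K

  IsCycle : Subset n → Subset m → Set
  IsCycle S F = Connected S F × (∀ x → x ∈ S → deg F x ≡ 2)

  Triangle : Subset n → Subset m → Set
  Triangle S F = IsCycle S F × ∣ S ∣ ≡ 3

  Complex : Subset m → Subset n → Set
  Complex H K = Comp H K × ¬ TwoEC K (compEdges H K)

  Block : Subset m → Subset n → Subset m → Set
  Block H S F =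
    IsSubgraph S F × F ⊆ H × Nonempty F × TwoEC S F
    × (∀ S' F' → IsSubgraph S' F' → F' ⊆ H → S ⊆ S' → F ⊆ F' → TwoEC S' F'
         → (S' ≡ S × F' ≡ F))

  BlockOf : Subset m → Subset n → (Subset n × Subset m) → Set
  BlockOf H K (S , F) = Block H S F × S ⊆ K

  Bridge : Subset m → Fin m → Set
  Bridge H e = e ∈ H × ∃[ k ] ∃[ k' ]
    (NumComponents Full H k × NumComponents Full (H - e) k' × k < k')

  BridgeOf : Subset m → Subset n → Fin m → Set
  BridgeOf H K e = Bridge H e × e ∈ within K

  Canonical : Subset m → Set
  Canonical H =
      (∀ K → Comp H K → ¬ Triangle K (compEdges H K))
    × (∀ K → Comp H K → ∣ compEdges H K ∣ < 8 → IsCycle K (compEdges H K))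
    × (∀ K → Complex H K → ∀ S F → BlockOf H K (S , F) → 4 ≤ ∣ F ∣)
    × (∀ K → Complex H K → ∃[ B₁ ] ∃[ B₂ ]
         (BlockOf H K B₁ × BlockOf H K B₂ × B₁ ≢ B₂
          × 6 ≤ ∣ Data.Product.proj₂ B₁ ∣ × 6 ≤ ∣ Data.Product.proj₂ B₂ ∣))
    × (∃[ K ] (Comp H K × 8 ≤ ∣ K ∣))

  -- Credits, scaled by 4 (so that all values are natural numbers):
  -- CompCredit4 H K c  means  c = 4 · (credits attributable to component K),
  -- i.e. small 2EC: |E(C)|, large 2EC: 8,
  -- complex: 4 + 4·(#2EC blocks) + 1·(#bridges).

  CompCredit4 : Subset m → Subset n → ℕ → Set
  CompCredit4 H K c =
      (TwoEC K (compEdges H K) × ∣ compEdges H K ∣ < 8 × c ≡ ∣ compEdges H K ∣)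
    ⊎ (TwoEC K (compEdges H K) × 8 ≤ ∣ compEdges H K ∣ × c ≡ 8)
    ⊎ (¬ TwoEC K (compEdges H K) × ∃[ b ] ∃[ r ]
         (Count (BlockOf H K) b × Count (BridgeOf H K) r × c ≡ 4 + 4 * b + r))

  data SumCredit4 (H : Subset m) : List (Subset n) → ℕ → Set where
    []  : SumCredit4 H [] 0
    _∷_ : ∀ {K Ks c s} → CompCredit4 H K c → SumCredit4 H Ks s
        → SumCredit4 H (K ∷ Ks) (c + s)

  -- Cr4 H c  means  c = 4 · cr(H): sum over the list of all components
  Cr4 : Subset m → ℕ → Set
  Cr4 H c = ∃[ Ks ] (Unique Ks × (∀ K → (Comp H K ⇔ (K ∈ₗ Ks))) × SumCredit4 H Ks c)

  -- Cost4 H c  means  c = 4 · cost(H) = 4|H| + 4 cr(H)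
  Cost4 : Subset m → ℕ → Set
  Cost4 H c = ∃[ r ] (Cr4 H r × c ≡ 4 * ∣ H ∣ + r)

-- Everything is measured in quarter credits, and the credits of each component C of H are
-- charged to its own edges. A small 2EC component gets |E(C)|, a large one 8 ≤ |E(C)|. A
-- complex component with b 2EC blocks and r bridges gets 4 + 4b + r: two blocks sharing an
-- edge would have a 2EC union, so by maximality distinct blocks are edge-disjoint; each block
-- has at least 4 edges and two of them at least 6, and no bridge lies in a block, hence
-- |E(C)| ≥ 4b + 4 + r. Components are edge-disjoint, so 4 cr(H) ≤ |H|. Only the canonical
-- properties (3) and (4) enter. Since cost is given as a relation, its existence is part of the claim: it holds
-- because every notion in the credit scheme is decidable, reachability being decided by
-- expanding {x} along edges until the vertex set stops growing, which it does within n + 1 rounds.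
module Submission where

open import Defs
open import Data.Nat using (ℕ; _*_; _≤_)
open import Data.Fin.Subset using (Subset; ∣_∣)
open import Data.Product using (∃-syntax; _×_)

open import Data.Bool using (Bool; true; _∧_)
open import Data.Bool.Properties using (T-≡; ∧-conicalˡ; ∧-conicalʳ)
open import Data.Fin using (Fin)
import Data.Fin as Fin
open import Data.Fin.Properties using (any?; all?)
open import Data.Fin.Subset using (_∈_; _∉_; _⊆_; _∩_; _∪_; _─_; _-_; ⁅_⁆; ⋃; Empty; inside; outside; ⊤)
open import Data.Fin.Subset.Properties
open import Data.List
  using (List; []; _∷_; [_]; length; map; filter; deduplicate; cartesianProduct; cartesianProductWith; allFin)
open import Data.List.Membership.Propositional using () renaming (_∈_ to _∈ₗ_)
open import Data.List.Membership.Propositional.Properties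
  using ( ∈-filter⁺; ∈-filter⁻; ∈-deduplicate⁺; ∈-deduplicate⁻
        ; ∈-cartesianProductWith⁺; ∈-cartesianProduct⁺; ∈-allFin)
open import Data.List.Membership.Propositional.Properties.WithK using (unique∧set⇒bag)
open import Data.List.Relation.Binary.BagAndSetEquality using (∼bag⇒↭)
open import Data.List.Relation.Binary.Permutation.Propositional.Properties using (↭-length)
import Data.List.Relation.Unary.All as All
open import Data.List.Relation.Unary.AllPairs using (_∷_)
open import Data.List.Relation.Unary.Any using (here; there)
open import Data.List.Relation.Unary.Unique.DecPropositional.Properties using (deduplicate-!)
open import Data.List.Relation.Unary.Unique.Propositional using (Unique)
open import Data.Nat using (zero; suc; _+_; _<_; z≤n; _<?_)
open import Data.Nat.GeneralisedArithmetic using (iterate)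
open import Data.Nat.ListAction using (sum)
open import Data.Nat.Properties
open import Algebra.Properties.CommutativeSemigroup +-commutativeSemigroup using (x∙yz≈y∙xz)
open import Data.Product using (∃; _,_; proj₁; proj₂)
import Data.Product as Product
open import Data.Product.Properties using () renaming (≡-dec to ×-≡-dec)
open import Data.Sum using (_⊎_; inj₁; inj₂)
import Data.Sum as Sum
open import Data.Vec using ([]; _∷_; here; there; lookup; tabulate)
open import Data.Vec.Properties using ([]=⇒lookup; lookup⇒[]=; lookup∘tabulate) renaming (≡-dec to Vec-≡-dec)
open import Function using (_∘_; case_of_)
open import Function.Bundles using (_⇔_; mk⇔; Equivalence)
open import Function.Construct.Identity using (⇔-id)
open import Relation.Binary.Definitions using (DecidableEquality)
open import Relation.Binary.PropositionalEquality using (_≡_; _≢_; refl; sym; trans; cong; cong₂; subst; subst₂)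
open import Relation.Nullary using (¬_; Dec; yes; no; ⌊_⌋; contradiction)
open import Relation.Nullary.Decidable
  using (_×-dec_; _⊎-dec_; _→-dec_; ¬?; map′; decidable-stable; toWitness; fromWitness)
open import Relation.Unary using (Decidable)

open Equivalence using (to; from)

infix 2 _⇔-dec_
_⇔-dec_ : ∀ {A B : Set} → Dec A → Dec B → Dec (A ⇔ B)
a? ⇔-dec b? = map′ (λ (f , g) → mk⇔ f g) (λ A⇔B → to A⇔B , from A⇔B) ((a? →-dec b?) ×-dec (b? →-dec a?))

allSubsets? : ∀ {k} {P : Subset k → Set} → Decidable P → Dec (∀ p → P p)
allSubsets? P? =
  map′ (λ ¬∃¬P p → decidable-stable (P? p) (λ ¬Pp → ¬∃¬P (p , ¬Pp)))
       (λ ∀P (p , ¬Pp) → ¬Pp (∀P p))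
       (¬? (anySubset? (¬? ∘ P?)))

Subset-≟ : ∀ {k} → DecidableEquality (Subset k)
Subset-≟ = Vec-≡-dec Data.Bool._≟_

∈⇔lookup≡true : ∀ {k} {p : Subset k} {x} → x ∈ p ⇔ lookup p x ≡ true
∈⇔lookup≡true {p = p} {x} = mk⇔ []=⇒lookup (lookup⇒[]= x p)

∈-tabulate : ∀ {k} (f : Fin k → Bool) {x} → x ∈ tabulate f ⇔ f x ≡ true
∈-tabulate f {x} = mk⇔ (λ x∈ → trans (sym (lookup∘tabulate f x)) (to ∈⇔lookup≡true x∈))
                       (λ fx → from ∈⇔lookup≡true (trans (lookup∘tabulate f x) fx))

∈-tabulate-dec : ∀ {k} {P : Fin k → Set} (P? : Decidable P) {x} → x ∈ tabulate (⌊_⌋ ∘ P?) ⇔ P x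
∈-tabulate-dec P? {x} = mk⇔ (λ x∈ → toWitness {a? = P? x} (from T-≡ (to (∈-tabulate _) x∈)))
                           (λ Px → from (∈-tabulate _) (to T-≡ (fromWitness Px)))

x∈p─q⇒x∉q : ∀ {k} (p q : Subset k) {x} → x ∈ p ─ q → x ∉ q
x∈p─q⇒x∉q (_ ∷ p) (outside ∷ q) here ()
x∈p─q⇒x∉q (_ ∷ p) (_ ∷ q) (there x∈p─q) (there x∈q) = x∈p─q⇒x∉q p q x∈p─q x∈q

─-monoˡ : ∀ {k} {p q : Subset k} (r : Subset k) → p ⊆ q → p ─ r ⊆ q ─ r
─-monoˡ {p = p} r p⊆q x∈p─r = x∈p∧x∉q⇒x∈p─q (p⊆q (p─q⊆p p r x∈p─r)) (x∈p─q⇒x∉q p r x∈p─r)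

∣p∪q∣≡∣p∣+∣q∣ : ∀ {k} (p q : Subset k) → Empty (p ∩ q) → ∣ p ∪ q ∣ ≡ ∣ p ∣ + ∣ q ∣
∣p∪q∣≡∣p∣+∣q∣ [] [] _ = refl
∣p∪q∣≡∣p∣+∣q∣ (inside ∷ p) (inside ∷ q) disj = contradiction (Fin.zero , here) disj
∣p∪q∣≡∣p∣+∣q∣ (inside ∷ p) (outside ∷ q) disj = cong suc (∣p∪q∣≡∣p∣+∣q∣ p q (drop-∷-Empty disj))
∣p∪q∣≡∣p∣+∣q∣ (outside ∷ p) (inside ∷ q) disj =
  trans (cong suc (∣p∪q∣≡∣p∣+∣q∣ p q (drop-∷-Empty disj))) (sym (+-suc ∣ p ∣ ∣ q ∣))
∣p∪q∣≡∣p∣+∣q∣ (outside ∷ p) (outside ∷ q) disj = ∣p∪q∣≡∣p∣+∣q∣ p q (drop-∷-Empty disj)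

module _ {A : Set} {k : ℕ} (f : A → Subset k) where

  PairwiseDisjoint : List A → Set
  PairwiseDisjoint as = ∀ {a b} → a ∈ₗ as → b ∈ₗ as → a ≢ b → Empty (f a ∩ f b)

  x∈⋃map⁻ : ∀ as {x} → x ∈ ⋃ (map f as) → ∃[ a ] (a ∈ₗ as × x ∈ f a)
  x∈⋃map⁻ [] x∈ = contradiction x∈ ∉⊥
  x∈⋃map⁻ (a ∷ as) x∈ with x∈p∪q⁻ (f a) (⋃ (map f as)) x∈
  ... | inj₁ x∈fa = a , here refl , x∈fa
  ... | inj₂ x∈⋃ with x∈⋃map⁻ as x∈⋃
  ...   | b , b∈as , x∈fb = b , there b∈as , x∈fb

  ⋃map⊆ : ∀ as {T} → (∀ {a} → a ∈ₗ as → f a ⊆ T) → ⋃ (map f as) ⊆ T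
  ⋃map⊆ as fa⊆T x∈ with x∈⋃map⁻ as x∈
  ... | a , a∈as , x∈fa = fa⊆T a∈as x∈fa

  ∣⋃map∣≡sum : ∀ as → Unique as → PairwiseDisjoint as → ∣ ⋃ (map f as) ∣ ≡ sum (map (∣_∣ ∘ f) as)
  ∣⋃map∣≡sum [] _ _ = ∣⊥∣≡0 k
  ∣⋃map∣≡sum (a ∷ as) (a∉as ∷ as!) disj =
    trans (∣p∪q∣≡∣p∣+∣q∣ (f a) (⋃ (map f as)) fa∩⋃=∅)
          (cong (∣ f a ∣ +_) (∣⋃map∣≡sum as as! (λ b∈ c∈ → disj (there b∈) (there c∈))))
    where
    fa∩⋃=∅ : Empty (f a ∩ ⋃ (map f as))
    fa∩⋃=∅ (x , x∈∩) with x∈p∩q⁻ (f a) _ x∈∩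
    ... | x∈fa , x∈⋃ with x∈⋃map⁻ as x∈⋃
    ...   | b , b∈as , x∈fb = disj (here refl) (there b∈as) (All.lookup a∉as b∈as) (x , x∈p∩q⁺ (x∈fa , x∈fb))

module _ {A : Set} (g : A → ℕ) {w : ℕ} where

  length*≤sum : ∀ xs → (∀ {a} → a ∈ₗ xs → w ≤ g a) → length xs * w ≤ sum (map g xs)
  length*≤sum [] _ = z≤n
  length*≤sum (a ∷ xs) light = +-mono-≤ (light (here refl)) (length*≤sum xs (light ∘ there))

  +length*≤sum : ∀ xs {x d} → (∀ {a} → a ∈ₗ xs → w ≤ g a) → x ∈ₗ xs → d + w ≤ g x
               → d + length xs * w ≤ sum (map g xs)
  +length*≤sum (a ∷ xs) {d = d} light (here refl) heavy =
    ≤-trans (≤-reflexive (sym (+-assoc d w (length xs * w))))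
            (+-mono-≤ heavy (length*≤sum xs (light ∘ there)))
  +length*≤sum (a ∷ xs) {d = d} light (there x∈xs) heavy =
    ≤-trans (≤-reflexive (x∙yz≈y∙xz d w (length xs * w)))
            (+-mono-≤ (light (here refl)) (+length*≤sum xs (light ∘ there) x∈xs heavy))

  private
    heavy-first : ∀ d L → d + (d + (w + L)) ≡ (d + w) + (d + L)
    heavy-first d L = trans (cong (d +_) (x∙yz≈y∙xz d w L)) (sym (+-assoc d w (d + L)))

    light-first : ∀ d L → d + (d + (w + L)) ≡ w + (d + (d + L))
    light-first d L = trans (cong (d +_) (x∙yz≈y∙xz d w L)) (x∙yz≈y∙xz d w (d + L))

  ++length*≤sum : ∀ xs {x y d} → (∀ {a} → a ∈ₗ xs → w ≤ g a) → x ∈ₗ xs → y ∈ₗ xs → x ≢ y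
                → d + w ≤ g x → d + w ≤ g y → d + (d + length xs * w) ≤ sum (map g xs)
  ++length*≤sum (a ∷ xs) light (here refl) (here refl) x≢y _ _ = contradiction refl x≢y
  ++length*≤sum (a ∷ xs) {d = d} light (here refl) (there y∈xs) _ heavyˣ heavyʸ =
    ≤-trans (≤-reflexive (heavy-first d (length xs * w)))
            (+-mono-≤ heavyˣ (+length*≤sum xs (light ∘ there) y∈xs heavyʸ))
  ++length*≤sum (a ∷ xs) {d = d} light (there x∈xs) (here refl) _ heavyˣ heavyʸ =
    ≤-trans (≤-reflexive (heavy-first d (length xs * w)))
            (+-mono-≤ heavyʸ (+length*≤sum xs (light ∘ there) x∈xs heavyˣ))
  ++length*≤sum (a ∷ xs) {d = d} light (there x∈xs) (there y∈xs) x≢y heavyˣ heavyʸ =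
    ≤-trans (≤-reflexive (light-first d (length xs * w)))
            (+-mono-≤ (light (here refl)) (++length*≤sum xs (light ∘ there) x∈xs y∈xs x≢y heavyˣ heavyʸ))

length≤∣⋃map⁅⁆∣ : ∀ {k} (rs : List (Fin k)) → Unique rs → length rs ≤ ∣ ⋃ (map ⁅_⁆ rs) ∣
length≤∣⋃map⁅⁆∣ rs rs! = begin
    length rs                   ≡⟨ *-identityʳ (length rs) ⟨
    length rs * 1               ≤⟨ length*≤sum (∣_∣ ∘ ⁅_⁆) rs (λ {r} _ → ≤-reflexive (sym (∣⁅x⁆∣≡1 r))) ⟩
    sum (map (∣_∣ ∘ ⁅_⁆) rs)    ≡⟨ ∣⋃map∣≡sum ⁅_⁆ rs rs! singletons-disjoint ⟨
    ∣ ⋃ (map ⁅_⁆ rs) ∣          ∎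
  where
  open ≤-Reasoning
  singletons-disjoint : PairwiseDisjoint ⁅_⁆ rs
  singletons-disjoint {r₁} {r₂} _ _ r₁≢r₂ (x , x∈∩) with x∈p∩q⁻ ⁅ r₁ ⁆ ⁅ r₂ ⁆ x∈∩
  ... | x∈⁅r₁⁆ , x∈⁅r₂⁆ = r₁≢r₂ (trans (sym (x∈⁅y⁆⇒x≡y r₁ x∈⁅r₁⁆)) (x∈⁅y⁆⇒x≡y r₂ x∈⁅r₂⁆))

count-unique : ∀ {A : Set} {P Q : A → Set} {k l} → (∀ x → P x ⇔ Q x) → Count P k → Count Q l → k ≡ l
count-unique P⇔Q (xs , xs! , P⇔∈xs , refl) (ys , ys! , Q⇔∈ys , refl) =
  ↭-length (∼bag⇒↭ (unique∧set⇒bag xs! ys! λ {x} →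
    mk⇔ (to (Q⇔∈ys x) ∘ to (P⇔Q x) ∘ from (P⇔∈xs x)) (to (P⇔∈xs x) ∘ from (P⇔Q x) ∘ from (Q⇔∈ys x))))

count : ∀ {A : Set} → DecidableEquality A → (xs : List A) → (∀ x → x ∈ₗ xs)
      → {P : A → Set} → Decidable P → ∃ (Count P)
count _≟_ xs ∈xs P? =
  _ , deduplicate _≟_ (filter P? xs) , deduplicate-! _≟_ (filter P? xs)
    , (λ x → mk⇔ (λ Px → ∈-deduplicate⁺ _≟_ (∈-filter⁺ P? {xs = xs} (∈xs x) Px))
                 (λ x∈ → proj₂ (∈-filter⁻ P? {xs = xs} (∈-deduplicate⁻ _≟_ (filter P? xs) x∈))))
    , refl

subsets : ∀ k → List (Subset k)
subsets zero = [ [] ]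
subsets (suc k) = cartesianProductWith _∷_ (inside ∷ outside ∷ []) (subsets k)

∈-subsets : ∀ {k} (p : Subset k) → p ∈ₗ subsets k
∈-subsets [] = here refl
∈-subsets (inside ∷ p) =
  ∈-cartesianProductWith⁺ _∷_ {xs = inside ∷ outside ∷ []} (here refl) (∈-subsets p)
∈-subsets (outside ∷ p) =
  ∈-cartesianProductWith⁺ _∷_ {xs = inside ∷ outside ∷ []} (there (here refl)) (∈-subsets p)

countFin : ∀ {k} {P : Fin k → Set} → Decidable P → ∃ (Count P)
countFin = count Fin._≟_ (allFin _) ∈-allFin

countSubset : ∀ {k} {P : Subset k → Set} → Decidable P → ∃ (Count P)
countSubset = count Subset-≟ (subsets _) ∈-subsets

countSubset² : ∀ {k l} {P : Subset k × Subset l → Set} → Decidable P → ∃ (Count P)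
countSubset² = count (×-≡-dec Subset-≟ Subset-≟) (cartesianProduct (subsets _) (subsets _))
                     (λ (p , q) → ∈-cartesianProduct⁺ (∈-subsets p) (∈-subsets q))

module _ {k : ℕ} (Φ : Subset k → Subset k) (inflationary : ∀ p → p ⊆ Φ p) where

  iterate-fixed : ∀ {p} → Φ p ⊆ p → ∀ j → iterate Φ p j ≡ p
  iterate-fixed Φp⊆p zero = refl
  iterate-fixed {p} Φp⊆p (suc j) =
    trans (cong (λ q → iterate Φ q j) (⊆-antisym Φp⊆p (inflationary p))) (iterate-fixed Φp⊆p j)

  iterate-fixed-or-growing : ∀ j p → Φ (iterate Φ p j) ⊆ iterate Φ p j ⊎ j + ∣ p ∣ ≤ ∣ iterate Φ p j ∣
  iterate-fixed-or-growing zero p = inj₂ ≤-refl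
  iterate-fixed-or-growing (suc j) p with p ⊂? Φ p
  ... | yes p⊂Φp = Sum.map₂ grow (iterate-fixed-or-growing j (Φ p))
    where
    grow : j + ∣ Φ p ∣ ≤ ∣ iterate Φ (Φ p) j ∣ → suc j + ∣ p ∣ ≤ ∣ iterate Φ (Φ p) j ∣
    grow = ≤-trans (≤-reflexive (sym (+-suc j ∣ p ∣))) ∘ ≤-trans (+-monoʳ-≤ j (p⊂q⇒∣p∣<∣q∣ p⊂Φp))
  ... | no ¬p⊂Φp = inj₁ (subst (λ q → Φ q ⊆ q) (sym (iterate-fixed Φp⊆p (suc j))) Φp⊆p)
    where
    Φp⊆p : Φ p ⊆ p
    Φp⊆p {x} x∈Φp = decidable-stable (x ∈? p) (λ x∉p → ¬p⊂Φp (inflationary p , x , x∈Φp , x∉p))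

  iterate-fixpoint : ∀ p → Φ (iterate Φ p (suc k)) ⊆ iterate Φ p (suc k)
  iterate-fixpoint p with iterate-fixed-or-growing (suc k) p
  ... | inj₁ fixed = fixed
  ... | inj₂ grown = contradiction (∣p∣≤n (iterate Φ p (suc k))) (<⇒≱ (≤-trans (m≤m+n (suc k) ∣ p ∣) grown))

  ⊆-iterate : ∀ p j → p ⊆ iterate Φ p j
  ⊆-iterate p zero = ⊆-refl
  ⊆-iterate p (suc j) = ⊆-iterate (Φ p) j ∘ inflationary p

module _ (G : Graph) where
  open Graph G

  private
    variable
      F F₁ F₂ H : Subset m
      S S₁ S₂ K K₁ K₂ : Subset n
      x y z : Fin n

  Adj-sym : Adj G F x y → Adj G F y x
  Adj-sym (e , e∈F , inj₁ ends) = e , e∈F , inj₂ ends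
  Adj-sym (e , e∈F , inj₂ ends) = e , e∈F , inj₁ ends

  Adj-mono : F₁ ⊆ F₂ → Adj G F₁ x y → Adj G F₂ x y
  Adj-mono F₁⊆F₂ (e , e∈F₁ , ends) = e , F₁⊆F₂ e∈F₁ , ends

  Adj? : ∀ F x y → Dec (Adj G F x y)
  Adj? F x y = any? λ e →
    e ∈? F ×-dec ((src e Fin.≟ x ×-dec tgt e Fin.≟ y) ⊎-dec (src e Fin.≟ y ×-dec tgt e Fin.≟ x))

  Reach-mono : F₁ ⊆ F₂ → Reach G F₁ x y → Reach G F₂ x y
  Reach-mono F₁⊆F₂ here = here
  Reach-mono F₁⊆F₂ (step adj walk) = step (Adj-mono F₁⊆F₂ adj) (Reach-mono F₁⊆F₂ walk)

  Reach-trans : Reach G F x y → Reach G F y z → Reach G F x z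
  Reach-trans here walk = walk
  Reach-trans (step adj walk₁) walk₂ = step adj (Reach-trans walk₁ walk₂)

  Reach-sym : Reach G F x y → Reach G F y x
  Reach-sym here = here
  Reach-sym (step adj walk) = Reach-trans (Reach-sym walk) (step (Adj-sym adj) here)

  expand : Subset m → Subset n → Subset n
  expand F S = tabulate (⌊_⌋ ∘ λ y → y ∈? S ⊎-dec any? (λ x → x ∈? S ×-dec Adj? F x y))

  ⊆-expand : ∀ S → S ⊆ expand F S
  ⊆-expand S x∈S = from (∈-tabulate-dec _) (inj₁ x∈S)

  reachable : Subset m → Fin n → Subset n
  reachable F x = iterate (expand F) ⁅ x ⁆ (suc n)

  reachable-sound : y ∈ reachable F x → Reach G F x y
  reachable-sound {F = F} {x = x} =
    sound (suc n) ⁅ x ⁆ (λ z∈⁅x⁆ → subst (Reach G F x) (sym (x∈⁅y⁆⇒x≡y x z∈⁅x⁆)) here)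
    where
    sound : ∀ j S → (∀ {z} → z ∈ S → Reach G F x z) → ∀ {y} → y ∈ iterate (expand F) S j → Reach G F x y
    sound zero S reach y∈S = reach y∈S
    sound (suc j) S reach = sound j (expand F S) λ z∈ → case to (∈-tabulate-dec _) z∈ of λ where
      (inj₁ z∈S) → reach z∈S
      (inj₂ (w , w∈S , adj)) → Reach-trans (reach w∈S) (step adj here)

  reachable-complete : Reach G F x y → y ∈ reachable F x
  reachable-complete {F = F} {x = x} walk = stay walk (⊆-iterate (expand F) ⊆-expand ⁅ x ⁆ (suc n) (x∈⁅x⁆ x))
    where
    stay : Reach G F z y → z ∈ reachable F x → y ∈ reachable F x
    stay here z∈ = z∈
    stay (step adj walk) z∈ =
      stay walk (iterate-fixpoint (expand F) ⊆-expand ⁅ x ⁆ (from (∈-tabulate-dec _) (inj₂ (_ , z∈ , adj))))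

  Reach? : ∀ F x y → Dec (Reach G F x y)
  Reach? F x y = map′ reachable-sound reachable-complete (y ∈? reachable F x)

  Connected? : ∀ S F → Dec (Connected G S F)
  Connected? S F = nonempty? S ×-dec all? λ x → all? λ y → x ∈? S →-dec y ∈? S →-dec Reach? F x y

  TwoEC? : ∀ S F → Dec (TwoEC G S F)
  TwoEC? S F = Connected? S F ×-dec all? λ e → e ∈? F →-dec Connected? S (F - e)

  IsComponent? : ∀ S F K → Dec (IsComponent G S F K)
  IsComponent? S F K = K ⊆? S ×-dec nonempty? K ×-dec
    all? λ x → x ∈? K →-dec all? λ y → y ∈? K ⇔-dec (y ∈? S ×-dec Reach? F x y)

  IsSubgraph? : ∀ S F → Dec (IsSubgraph G S F)
  IsSubgraph? S F = all? λ e → e ∈? F →-dec (src e ∈? S ×-dec tgt e ∈? S)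

  Block? : ∀ H S F → Dec (Block G H S F)
  Block? H S F = IsSubgraph? S F ×-dec F ⊆? H ×-dec nonempty? F ×-dec TwoEC? S F ×-dec
    allSubsets? λ S′ → allSubsets? λ F′ → IsSubgraph? S′ F′ →-dec F′ ⊆? H →-dec S ⊆? S′ →-dec F ⊆? F′ →-dec
      TwoEC? S′ F′ →-dec (Subset-≟ S′ S ×-dec Subset-≟ F′ F)

  BlockOf? : ∀ H K B → Dec (BlockOf G H K B)
  BlockOf? H K (S , F) = Block? H S F ×-dec S ⊆? K

  components : ∀ F → ∃ (NumComponents G ⊤ F)
  components F = countSubset (IsComponent? ⊤ F)

  Bridge? : ∀ H e → Dec (Bridge G H e)
  Bridge? H e with components H | components (H - e)
  ... | k , #H | l , #H-e = map′
    (λ (e∈H , k<l) → e∈H , k , l , #H , #H-e , k<l)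
    (λ (e∈H , k′ , l′ , #H′ , #H-e′ , k′<l′) →
       e∈H , subst₂ _<_ (count-unique (λ _ → ⇔-id _) #H′ #H) (count-unique (λ _ → ⇔-id _) #H-e′ #H-e) k′<l′)
    (e ∈? H ×-dec k <? l)

  BridgeOf? : ∀ H K e → Dec (BridgeOf G H K e)
  BridgeOf? H K e = Bridge? H e ×-dec e ∈? within G K

  ∈-within : ∀ {X e} → e ∈ within G X ⇔ (src e ∈ X × tgt e ∈ X)
  ∈-within {X} {e} = mk⇔
    (λ e∈ → let both = to (∈-tabulate _) e∈ in
      from ∈⇔lookup≡true (∧-conicalˡ _ _ both) , from ∈⇔lookup≡true (∧-conicalʳ _ _ both))
    (λ (s∈ , t∈) → from (∈-tabulate _) (cong₂ _∧_ (to ∈⇔lookup≡true s∈) (to ∈⇔lookup≡true t∈)))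

  Comp-≡ : Comp G H K₁ → Comp G H K₂ → x ∈ K₁ → x ∈ K₂ → K₁ ≡ K₂
  Comp-≡ {x = x} (_ , _ , comp₁) (_ , _ , comp₂) x∈K₁ x∈K₂ =
    ⊆-antisym (from (comp₂ x x∈K₂ _) ∘ to (comp₁ x x∈K₁ _)) (from (comp₁ x x∈K₁ _) ∘ to (comp₂ x x∈K₂ _))

  compEdges-disjoint : Comp G H K₁ → Comp G H K₂ → K₁ ≢ K₂ → Empty (compEdges G H K₁ ∩ compEdges G H K₂)
  compEdges-disjoint {H} {K₁} {K₂} comp₁ comp₂ K₁≢K₂ (e , e∈∩) =
    K₁≢K₂ (Comp-≡ comp₁ comp₂ (src∈ K₁ (proj₁ both)) (src∈ K₂ (proj₂ both)))
    where
    both = x∈p∩q⁻ (compEdges G H K₁) _ e∈∩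
    src∈ : ∀ X → e ∈ compEdges G H X → src e ∈ X
    src∈ X e∈ = proj₁ (to ∈-within (proj₂ (x∈p∩q⁻ H _ e∈)))

  Connected-mono : F₁ ⊆ F₂ → Connected G S F₁ → Connected G S F₂
  Connected-mono F₁⊆F₂ (nonempty , reach) = nonempty , λ x y x∈ y∈ → Reach-mono F₁⊆F₂ (reach x y x∈ y∈)

  Connected-∪ : Connected G S₁ F₁ → Connected G S₂ F₂ → x ∈ S₁ → x ∈ S₂ → Connected G (S₁ ∪ S₂) (F₁ ∪ F₂)
  Connected-∪ {S₁} {F₁} {S₂} {F₂} {x} (_ , reach₁) (_ , reach₂) x∈S₁ x∈S₂ =
    (x , p⊆p∪q S₂ x∈S₁) , λ y z y∈ z∈ → Reach-trans (to-x y∈) (Reach-sym (to-x z∈))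
    where
    to-x : ∀ {y} → y ∈ S₁ ∪ S₂ → Reach G (F₁ ∪ F₂) y x
    to-x {y} y∈ with x∈p∪q⁻ S₁ S₂ y∈
    ... | inj₁ y∈S₁ = Reach-mono (p⊆p∪q F₂) (reach₁ y x y∈S₁ x∈S₁)
    ... | inj₂ y∈S₂ = Reach-mono (q⊆p∪q F₁ F₂) (reach₂ y x y∈S₂ x∈S₂)

  TwoEC⇒Connected-minus : TwoEC G S F → ∀ e → Connected G S (F - e)
  TwoEC⇒Connected-minus {F = F} (connected , bridgeless) e with e ∈? F
  ... | yes e∈F = bridgeless e e∈F
  ... | no e∉F = Connected-mono (λ f∈F → x∈p∧x≢y⇒x∈p-y f∈F λ { refl → e∉F f∈F }) connected

  TwoEC-∪ : TwoEC G S₁ F₁ → TwoEC G S₂ F₂ → x ∈ S₁ → x ∈ S₂ → TwoEC G (S₁ ∪ S₂) (F₁ ∪ F₂)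
  TwoEC-∪ {F₁ = F₁} {F₂ = F₂} 2ec₁ 2ec₂ x∈S₁ x∈S₂ =
    Connected-∪ (proj₁ 2ec₁) (proj₁ 2ec₂) x∈S₁ x∈S₂ ,
    λ e _ → Connected-mono (∪-minus e)
              (Connected-∪ (TwoEC⇒Connected-minus 2ec₁ e) (TwoEC⇒Connected-minus 2ec₂ e) x∈S₁ x∈S₂)
    where
    ∪-minus : ∀ e → (F₁ - e) ∪ (F₂ - e) ⊆ (F₁ ∪ F₂) - e
    ∪-minus e f∈ with x∈p∪q⁻ (F₁ - e) (F₂ - e) f∈
    ... | inj₁ f∈F₁-e = ─-monoˡ ⁅ e ⁆ (p⊆p∪q F₂) f∈F₁-e
    ... | inj₂ f∈F₂-e = ─-monoˡ ⁅ e ⁆ (q⊆p∪q F₁ F₂) f∈F₂-e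

  IsSubgraph-∪ : IsSubgraph G S₁ F₁ → IsSubgraph G S₂ F₂ → IsSubgraph G (S₁ ∪ S₂) (F₁ ∪ F₂)
  IsSubgraph-∪ {S₁} {F₁} {S₂} {F₂} sub₁ sub₂ e e∈ with x∈p∪q⁻ F₁ F₂ e∈
  ... | inj₁ e∈F₁ = Product.map (p⊆p∪q S₂) (p⊆p∪q S₂) (sub₁ e e∈F₁)
  ... | inj₂ e∈F₂ = Product.map (q⊆p∪q S₁ S₂) (q⊆p∪q S₁ S₂) (sub₂ e e∈F₂)

  Block-≡ : ∀ {e} → Block G H S₁ F₁ → Block G H S₂ F₂ → e ∈ F₁ → e ∈ F₂ → (S₁ , F₁) ≡ (S₂ , F₂)
  Block-≡ {H} {S₁} {F₁} {S₂} {F₂} {e}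
          (sub₁ , F₁⊆H , _ , 2ec₁ , max₁) (sub₂ , F₂⊆H , _ , 2ec₂ , max₂) e∈F₁ e∈F₂ =
    cong₂ _,_ (trans (sym (proj₁ ∪≡₁)) (proj₁ ∪≡₂)) (trans (sym (proj₂ ∪≡₁)) (proj₂ ∪≡₂))
    where
    ∪⊆H : F₁ ∪ F₂ ⊆ H
    ∪⊆H f∈ = Sum.[ F₁⊆H , F₂⊆H ] (x∈p∪q⁻ F₁ F₂ f∈)
    ∪-2ec : TwoEC G (S₁ ∪ S₂) (F₁ ∪ F₂)
    ∪-2ec = TwoEC-∪ 2ec₁ 2ec₂ (proj₁ (sub₁ e e∈F₁)) (proj₁ (sub₂ e e∈F₂))
    ∪≡₁ = max₁ _ _ (IsSubgraph-∪ sub₁ sub₂) ∪⊆H (p⊆p∪q S₂) (p⊆p∪q F₂) ∪-2ec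
    ∪≡₂ = max₂ _ _ (IsSubgraph-∪ sub₁ sub₂) ∪⊆H (q⊆p∪q S₁ S₂) (q⊆p∪q F₁ F₂) ∪-2ec

  BlockOf-disjoint : ∀ {B₁ B₂} → BlockOf G H K B₁ → BlockOf G H K B₂ → B₁ ≢ B₂ → Empty (proj₂ B₁ ∩ proj₂ B₂)
  BlockOf-disjoint {B₁ = _ , F₁} {_ , F₂} (block₁ , _) (block₂ , _) B₁≢B₂ (e , e∈∩) =
    B₁≢B₂ (Block-≡ block₁ block₂ (proj₁ (x∈p∩q⁻ F₁ F₂ e∈∩)) (proj₂ (x∈p∩q⁻ F₁ F₂ e∈∩)))

  Reach-bypass : ∀ {e} → Reach G (H - e) (src e) (tgt e) → Reach G H x y → Reach G (H - e) x y
  Reach-bypass bypass here = here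
  Reach-bypass {e = e} bypass (step (f , f∈H , ends) walk) with f Fin.≟ e
  ... | no f≢e = step (f , x∈p∧x≢y⇒x∈p-y f∈H f≢e , ends) (Reach-bypass bypass walk)
  ... | yes refl with ends
  ...   | inj₁ (refl , refl) = Reach-trans bypass (Reach-bypass bypass walk)
  ...   | inj₂ (refl , refl) = Reach-trans (Reach-sym bypass) (Reach-bypass bypass walk)

  IsComponent-cong : (∀ {x y} → Reach G F₁ x y ⇔ Reach G F₂ x y) → IsComponent G S F₁ K ⇔ IsComponent G S F₂ K
  IsComponent-cong {S = S} {K = K} reach⇔ =
    mk⇔ (transfer (to reach⇔) (from reach⇔)) (transfer (from reach⇔) (to reach⇔))
    where
    transfer : ∀ {F F′} → (∀ {x y} → Reach G F x y → Reach G F′ x y) → (∀ {x y} → Reach G F′ x y → Reach G F x y)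
             → IsComponent G S F K → IsComponent G S F′ K
    transfer fwd bwd (K⊆S , nonempty , comp) = K⊆S , nonempty , λ x x∈K y →
      mk⇔ (Product.map₂ fwd ∘ to (comp x x∈K y)) (from (comp x x∈K y) ∘ Product.map₂ bwd)

  TwoEC-edge-not-Bridge : ∀ {e} → IsSubgraph G S F → F ⊆ H → TwoEC G S F → e ∈ F → ¬ Bridge G H e
  TwoEC-edge-not-Bridge {S} {F} {H} {e} sub F⊆H 2ec e∈F (_ , k , l , #H , #H-e , k<l) =
    <-irrefl (count-unique (λ _ → IsComponent-cong same-reach) #H #H-e) k<l
    where
    bypass : Reach G (H - e) (src e) (tgt e)
    bypass = Reach-mono (─-monoˡ ⁅ e ⁆ F⊆H)
               (proj₂ (TwoEC⇒Connected-minus 2ec e) _ _ (proj₁ (sub e e∈F)) (proj₂ (sub e e∈F)))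
    same-reach : ∀ {x y} → Reach G H x y ⇔ Reach G (H - e) x y
    same-reach = mk⇔ (Reach-bypass bypass) (Reach-mono (p─q⊆p H ⁅ e ⁆))

  BlockOf⊆compEdges : BlockOf G H K (S , F) → F ⊆ compEdges G H K
  BlockOf⊆compEdges ((sub , F⊆H , _) , S⊆K) {e} e∈F =
    x∈p∩q⁺ (F⊆H e∈F , from ∈-within (Product.map S⊆K S⊆K (sub e e∈F)))

  BridgeOf⊆compEdges : ∀ {e} → BridgeOf G H K e → ⁅ e ⁆ ⊆ compEdges G H K
  BridgeOf⊆compEdges {e = e} ((e∈H , _) , e∈within) f∈⁅e⁆ rewrite x∈⁅y⁆⇒x≡y e f∈⁅e⁆ = x∈p∩q⁺ (e∈H , e∈within)

  BlockOf-edge-not-Bridge : ∀ {e} → BlockOf G H K (S , F) → e ∈ F → ¬ Bridge G H e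
  BlockOf-edge-not-Bridge ((sub , F⊆H , _ , 2ec , _) , _) = TwoEC-edge-not-Bridge sub F⊆H 2ec

  blocks∩bridges=∅ : ∀ {bs rs} → (∀ {B} → B ∈ₗ bs → BlockOf G H K B) → (∀ {r} → r ∈ₗ rs → Bridge G H r)
                   → Empty (⋃ (map proj₂ bs) ∩ ⋃ (map ⁅_⁆ rs))
  blocks∩bridges=∅ {bs = bs} {rs} blockOf bridge (e , e∈∩) with x∈p∩q⁻ (⋃ (map proj₂ bs)) _ e∈∩
  ... | e∈blocks , e∈bridges with x∈⋃map⁻ proj₂ bs e∈blocks | x∈⋃map⁻ ⁅_⁆ rs e∈bridges
  ...   | (S , F) , B∈ , e∈F | r , r∈ , e∈⁅r⁆ rewrite x∈⁅y⁆⇒x≡y r e∈⁅r⁆ =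
    BlockOf-edge-not-Bridge (blockOf B∈) e∈F (bridge r∈)

  complex-credit≤ : Canonical G H → Complex G H K → ∀ {b r}
                  → Count (BlockOf G H K) b → Count (BridgeOf G H K) r → 4 + 4 * b + r ≤ ∣ compEdges G H K ∣
  complex-credit≤ {H} {K} (_ , _ , blocks≥4 , two-big , _) complex
                  (bs , bs! , ∈bs , refl) (rs , rs! , ∈rs , refl) = begin
      4 + 4 * length bs + length rs
    ≡⟨ cong (λ t → 4 + t + length rs) (*-comm 4 (length bs)) ⟩
      2 + (2 + length bs * 4) + length rs
    ≤⟨ +-mono-≤ block-edges (length≤∣⋃map⁅⁆∣ rs rs!) ⟩
      ∣ ⋃ (map proj₂ bs) ∣ + ∣ ⋃ (map ⁅_⁆ rs) ∣
    ≡⟨ ∣p∪q∣≡∣p∣+∣q∣ _ _ (blocks∩bridges=∅ blockOf (proj₁ ∘ bridgeOf)) ⟨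
      ∣ ⋃ (map proj₂ bs) ∪ ⋃ (map ⁅_⁆ rs) ∣
    ≤⟨ p⊆q⇒∣p∣≤∣q∣ (λ e∈ → Sum.[ ⋃map⊆ proj₂ bs blocks⊆ , ⋃map⊆ ⁅_⁆ rs bridges⊆ ] (x∈p∪q⁻ _ _ e∈)) ⟩
      ∣ compEdges G H K ∣
    ∎
    where
    open ≤-Reasoning
    blockOf : ∀ {B} → B ∈ₗ bs → BlockOf G H K B
    blockOf {B} = from (∈bs B)
    bridgeOf : ∀ {r} → r ∈ₗ rs → BridgeOf G H K r
    bridgeOf {r} = from (∈rs r)
    blocks⊆ : ∀ {B} → B ∈ₗ bs → proj₂ B ⊆ compEdges G H K
    blocks⊆ {S , F} = BlockOf⊆compEdges ∘ blockOf
    bridges⊆ : ∀ {r} → r ∈ₗ rs → ⁅ r ⁆ ⊆ compEdges G H K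
    bridges⊆ = BridgeOf⊆compEdges {K = K} ∘ bridgeOf
    block-edges : 2 + (2 + length bs * 4) ≤ ∣ ⋃ (map proj₂ bs) ∣
    block-edges with two-big K complex
    ... | B₁ , B₂ , big₁ , big₂ , B₁≢B₂ , six₁ , six₂ = begin
        2 + (2 + length bs * 4)
      ≤⟨ ++length*≤sum (∣_∣ ∘ proj₂) bs {d = 2} (λ { {S , F} B∈ → blocks≥4 K complex S F (blockOf B∈) })
                       (to (∈bs B₁) big₁) (to (∈bs B₂) big₂) B₁≢B₂ six₁ six₂ ⟩
        sum (map (∣_∣ ∘ proj₂) bs)
      ≡⟨ ∣⋃map∣≡sum proj₂ bs bs! (λ B₁∈ B₂∈ → BlockOf-disjoint (blockOf B₁∈) (blockOf B₂∈)) ⟨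
        ∣ ⋃ (map proj₂ bs) ∣
      ∎

  compCredit≤ : Canonical G H → Comp G H K → ∀ {c} → CompCredit4 G H K c → c ≤ ∣ compEdges G H K ∣
  compCredit≤ _ _ (inj₁ (_ , _ , refl)) = ≤-refl
  compCredit≤ _ _ (inj₂ (inj₁ (_ , large , refl))) = large
  compCredit≤ canonical comp (inj₂ (inj₂ (¬2ec , _ , _ , #blocks , #bridges , refl))) =
    complex-credit≤ canonical (comp , ¬2ec) #blocks #bridges

  sumCredit≤ : Canonical G H → ∀ {Ks s} → SumCredit4 G H Ks s → (∀ {K} → K ∈ₗ Ks → Comp G H K)
             → s ≤ sum (map (∣_∣ ∘ compEdges G H) Ks)
  sumCredit≤ _ [] _ = z≤n
  sumCredit≤ canonical (credit ∷ credits) comp =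
    +-mono-≤ (compCredit≤ canonical (comp (here refl)) credit) (sumCredit≤ canonical credits (comp ∘ there))

  credits≤edges : Canonical G H → ∀ {r} → Cr4 G H r → r ≤ ∣ H ∣
  credits≤edges {H} canonical {r} (Ks , Ks! , ∈Ks , credits) = begin
      r
    ≤⟨ sumCredit≤ canonical credits comp ⟩
      sum (map (∣_∣ ∘ compEdges G H) Ks)
    ≡⟨ ∣⋃map∣≡sum (compEdges G H) Ks Ks! (λ K₁∈ K₂∈ → compEdges-disjoint (comp K₁∈) (comp K₂∈)) ⟨
      ∣ ⋃ (map (compEdges G H) Ks) ∣
    ≤⟨ p⊆q⇒∣p∣≤∣q∣ (⋃map⊆ (compEdges G H) Ks (λ _ → p∩q⊆p H _)) ⟩
      ∣ H ∣
    ∎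
    where
    open ≤-Reasoning
    comp : ∀ {K} → K ∈ₗ Ks → Comp G H K
    comp {K} = from (∈Ks K)

  cost≤ : Canonical G H → ∀ {c} → Cost4 G H c → c ≤ 5 * ∣ H ∣
  cost≤ {H} canonical (r , credits , refl) = begin
      4 * ∣ H ∣ + r     ≤⟨ +-monoʳ-≤ (4 * ∣ H ∣) (credits≤edges canonical credits) ⟩
      4 * ∣ H ∣ + ∣ H ∣ ≡⟨ +-comm (4 * ∣ H ∣) ∣ H ∣ ⟩
      5 * ∣ H ∣         ∎
    where open ≤-Reasoning

  compCredit : ∀ H K → ∃ (CompCredit4 G H K)
  compCredit H K with TwoEC? K (compEdges G H K) | ∣ compEdges G H K ∣ <? 8
  ... | yes 2ec | yes small = _ , inj₁ (2ec , small , refl)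
  ... | yes 2ec | no ¬small = _ , inj₂ (inj₁ (2ec , ≮⇒≥ ¬small , refl))
  ... | no ¬2ec | _ =
    _ , inj₂ (inj₂ (¬2ec , _ , _ , proj₂ (countSubset² (BlockOf? H K)) , proj₂ (countFin (BridgeOf? H K)) , refl))

  sumCredit : ∀ H Ks → ∃ (SumCredit4 G H Ks)
  sumCredit H [] = _ , []
  sumCredit H (K ∷ Ks) = _ , proj₂ (compCredit H K) ∷ proj₂ (sumCredit H Ks)

  cost : ∀ H → ∃ (Cost4 G H)
  cost H with components H
  ... | _ , Ks , Ks! , ∈Ks , _ = _ , _ , (Ks , Ks! , ∈Ks , proj₂ (sumCredit H Ks)) , refl

lemma4 : (G : Graph) → Structured G 5 4 → (H : Subset (Graph.m G))
    → TwoEdgeCover G H → Canonical G H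
    → (∃[ c ] Cost4 G H c) × (∀ c → Cost4 G H c → c ≤ 5 * ∣ H ∣)
lemma4 G _ H _ canonical = cost G H , λ _ → cost≤ G canonical
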